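{- Let $A$ be a finite nonempty alphabet, let $S\subset A^*$ be a tree set and let $k=\mathrm{Card}(S\cap A)-1$. Then $\mathrm{Card}(S\cap A^n)=kn+1$ for all $n\ge0$.
   Context: $S$ is factorial if it contains all factors of its elements. For $w\in S$: $L(w)=\{a\in A\mid aw\in S\}$, $R(w)=\{a\in A\mid wa\in S\}$, $E(w)=\{(a,b)\mid awb\in S\}$; $S$ is biextendable if factorial and $E(w)\ne\emptyset$ for all $w$. The extension graph of $w$ is the undirected bipartite graph with vertex set the disjoint union of $L(w)$ and $R(w)$ and an edge $a$–$b$ for each $(a,b)\in E(w)$; $S$ is a tree set if biextendable and every extension graph is a tree. -}

module Defs where

open import Data.Nat using (ℕ; _≤_)
open import Data.Fin using (Fin)
open import Data.List using (List; []; _∷_; _++_; [_]; length)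
open import Data.List.Membership.Propositional using (_∈_)
open import Data.List.Relation.Unary.Unique.Propositional using (Unique)
open import Data.List.Relation.Unary.Linked using (Linked)
open import Data.Product using (Σ; ∃; ∃-syntax; _×_; _,_)
open import Data.Sum using (_⊎_; inj₁; inj₂)
open import Data.Empty using (⊥)
open import Relation.Nullary using (¬_)
open import Relation.Binary.PropositionalEquality using (_≡_)
open import Relation.Binary.Construct.Closure.ReflexiveTransitive using (Star)
open import Function.Bundles using (_⇔_)

Word : ℕ → Set
Word m = List (Fin m)

Lang : ℕ → Set₁
Lang m = Word m → Set

Factor : {m : ℕ} → Word m → Word m → Set
Factor u w = ∃[ x ] ∃[ y ] (x ++ u ++ y ≡ w)

Factorial : {m : ℕ} → Lang m → Set
Factorial S = ∀ w u → S w → Factor u w → S u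

Biextendable : {m : ℕ} → Lang m → Set
Biextendable {m} S =
  Factorial S × (∀ w → S w → ∃[ a ] ∃[ b ] S (a ∷ w ++ [ b ]))

record Graph (V : Set) : Set₁ where
  field
    IsVertex : V → Set
    Adj      : V → V → Set

module _ {V : Set} (G : Graph V) where
  open Graph G

  Connected : Set
  Connected = ∀ u v → IsVertex u → IsVertex v → Star Adj u v

  Cycle : Set
  Cycle = ∃[ v ] ∃[ vs ] (2 ≤ length vs × Unique (v ∷ vs)
                           × Linked Adj (v ∷ vs ++ [ v ]))

  Acyclic : Set
  Acyclic = ¬ Cycle

  IsTree : Set
  IsTree = Connected × Acyclic

-- Extension graph of w : bipartite graph on L(w) ⊔ R(w) with an edge
-- a – b for each (a , b) ∈ E(w).  Left copy = inj₁, right copy = inj₂.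

ExtVertex : {m : ℕ} → Lang m → Word m → Fin m ⊎ Fin m → Set
ExtVertex S w (inj₁ a) = S (a ∷ w)
ExtVertex S w (inj₂ b) = S (w ++ [ b ])

ExtAdj : {m : ℕ} → Lang m → Word m → Fin m ⊎ Fin m → Fin m ⊎ Fin m → Set
ExtAdj S w (inj₁ a) (inj₂ b) = S (a ∷ w ++ [ b ])
ExtAdj S w (inj₂ b) (inj₁ a) = S (a ∷ w ++ [ b ])
ExtAdj S w (inj₁ _) (inj₁ _) = ⊥
ExtAdj S w (inj₂ _) (inj₂ _) = ⊥

ExtensionGraph : {m : ℕ} → Lang m → Word m → Graph (Fin m ⊎ Fin m)
ExtensionGraph S w = record { IsVertex = ExtVertex S w ; Adj = ExtAdj S w }

TreeSet : {m : ℕ} → Lang m → Set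
TreeSet S = Biextendable S × (∀ w → S w → IsTree (ExtensionGraph S w))

HasCard : {m : ℕ} → (Word m → Set) → ℕ → Set
HasCard {m} P c =
  ∃[ ws ] (Unique ws × length ws ≡ c × (∀ (w : Word m) → (w ∈ ws ⇔ P w)))

_∩A^_ : {m : ℕ} → Lang m → ℕ → Word m → Set
(S ∩A^ n) w = S w × length w ≡ n

-- For a word w of S the extension graph is a tree on L(w) ⊔ R(w) with edge set E(w), so
-- |E(w)| + 1 = |L(w)| + |R(w)|.  Summing over the words w of length n, the E(w) partition
-- S ∩ A^(n+2), while the L(w) and the R(w) each partition S ∩ A^(n+1); hence the layer sizes
-- s(n) satisfy s(n+2) + s(n) = 2 s(n+1), and s(0) = 1, s(1) = k + 1 give s(n) = kn + 1.
-- Constructively the edges of a finite tree are enumerated by growing a spanning subtree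
-- along walks from a root; this is also what yields a finite listing of each new layer.

module Submission where

open import Defs
open import Data.Nat using (ℕ; zero; suc; _≤_; _*_; _+_; _∸_; s≤s; z≤n)
open import Data.Nat.Properties
  using (+-commutativeSemigroup; +-suc; +-assoc; +-comm; +-cancelʳ-≡; +-cancelˡ-≡; m∸n+n≡m; *-identityʳ; *-zeroʳ; suc-injective)
open import Data.Nat.ListAction using (sum)
open import Data.Nat.Tactic.RingSolver using (solve-∀)
open import Algebra.Properties.CommutativeSemigroup +-commutativeSemigroup using () renaming (interchange to +-interchange)
open import Data.Fin using (Fin)
import Data.Fin.Properties as Fin
open import Data.List using (List; []; _∷_; _++_; [_]; length; map; filter; allFin; initLast; _∷ʳ′_)
open import Data.List.Properties using (length-++; length-map; ++-identityʳ; ∷-injective; ∷ʳ-injective)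
import Data.List.Properties as List
open import Data.List.Membership.Propositional using (_∈_; _∉_)
open import Data.List.Membership.Propositional.Properties
  using (∈-++⁺ˡ; ∈-++⁺ʳ; ∈-++⁻; ∈-map⁺; ∈-map⁻; ∈-filter⁺; ∈-filter⁻; ∈-allFin; ∈-length)
open import Data.List.Membership.Propositional.Properties.WithK using (unique∧set⇒bag)
import Data.List.Membership.DecPropositional as DecMembership
open import Data.List.Relation.Binary.BagAndSetEquality using (∼bag⇒↭)
open import Data.List.Relation.Binary.Permutation.Propositional.Properties using (↭-length)
open import Data.List.Relation.Binary.Subset.Propositional using (_⊆_)
open import Data.List.Relation.Unary.All as All using (All; []; _∷_)
open import Data.List.Relation.Unary.All.Properties using (¬Any⇒All¬)
open import Data.List.Relation.Unary.AllPairs using ([]; _∷_)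
open import Data.List.Relation.Unary.Any using (here; there)
open import Data.List.Relation.Unary.Linked as Linked using (Linked; [-]; _∷_)
open import Data.List.Relation.Unary.Unique.Propositional using (Unique)
import Data.List.Relation.Unary.Unique.Propositional.Properties as Unique
open import Data.Product using (Σ; ∃; ∃-syntax; _×_; _,_; proj₁; proj₂; uncurry; swap)
import Data.Product.Properties as Product
open import Data.Sum using (_⊎_; inj₁; inj₂; [_,_]′)
import Data.Sum.Properties as Sum
open import Data.Empty using (⊥-elim)
open import Relation.Nullary using (¬_; Dec; yes; no; contradiction)
import Relation.Nullary.Decidable as Dec
open import Relation.Unary using (Decidable)
open import Relation.Binary.Definitions using (DecidableEquality)
open import Relation.Binary.PropositionalEquality
  using (_≡_; refl; sym; trans; cong; cong₂; subst; module ≡-Reasoning)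
open import Relation.Binary.Construct.Closure.ReflexiveTransitive as Star using (Star; ε; _◅_; _◅◅_)
open import Function using (_∘_; id)
open import Function.Bundles using (_⇔_; mk⇔; Equivalence)
import Function.Properties.Equivalence as ⇔
open Equivalence using (to; from)

record Listing {A : Set} (P : A → Set) : Set where
  field
    elements : List A
    unique   : Unique elements
    complete : ∀ x → x ∈ elements ⇔ P x

  size : ℕ
  size = length elements

open Listing

module _ {A : Set} {P : A → Set} where

  Listing-cong : {Q : A → Set} → (∀ x → P x ⇔ Q x) → Listing P → Listing Q
  Listing-cong P⇔Q l = record
    { elements = elements l
    ; unique   = unique l
    ; complete = λ x → ⇔.trans (complete l x) (P⇔Q x) }

  size-unique : (l l′ : Listing P) → size l ≡ size l′
  size-unique l l′ = ↭-length (∼bag⇒↭ (unique∧set⇒bag (unique l) (unique l′) same-members))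
    where
    same-members : ∀ {x} → x ∈ elements l ⇔ x ∈ elements l′
    same-members {x} = ⇔.trans (complete l x) (⇔.sym (complete l′ x))

  decide : DecidableEquality A → Listing P → Decidable P
  decide _≟_ l x = Dec.map (complete l x) (x ∈? elements l)
    where open DecMembership _≟_ using (_∈?_)

module _ {m} {P : Word m → Set} where

  toHasCard : (l : Listing P) → HasCard P (size l)
  toHasCard l = elements l , unique l , refl , complete l

  fromHasCard : ∀ {c} → HasCard P c → Σ (Listing P) λ l → size l ≡ c
  fromHasCard (ws , ws-unique , refl , ws-complete) =
    record { elements = ws ; unique = ws-unique ; complete = ws-complete } , refl

fin-listing : ∀ {m} {P : Fin m → Set} → Decidable P → Listing P
fin-listing {m} P? = record
  { elements = filter P? (allFin m)
  ; unique   = Unique.filter⁺ P? (Unique.allFin⁺ m)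
  ; complete = λ a → mk⇔ (proj₂ ∘ ∈-filter⁻ P? {xs = allFin m}) (∈-filter⁺ P? (∈-allFin a)) }

module _ {A B C : Set} (Q : A → B → Set) (f : A → B → C) where

  Image : List A → C → Set
  Image ws x = ∃[ u ] ∃[ b ] (u ∈ ws × Q u b × f u b ≡ x)

module _ {A B C : Set} {Q : A → B → Set} (f : A → B → C)
         (f-injective : ∀ {u u′ b b′} → f u b ≡ f u′ b′ → u ≡ u′ × b ≡ b′) where

  private
    elems : ∀ {ws} → All (λ u → Listing (Q u)) ws → List C
    elems []                = []
    elems {u ∷ _} (l ∷ ls) = map (f u) (elements l) ++ elems ls

    elems⁻ : ∀ {ws x} (ls : All (λ u → Listing (Q u)) ws) → x ∈ elems ls → Image Q f ws x
    elems⁻ {u ∷ _} (l ∷ ls) x∈ with ∈-++⁻ (map (f u) (elements l)) x∈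
    ... | inj₁ x∈l with b , b∈ , refl ← ∈-map⁻ (f u) x∈l =
      u , b , here refl , to (complete l b) b∈ , refl
    ... | inj₂ x∈ls with u′ , b , u′∈ , q , eq ← elems⁻ ls x∈ls = u′ , b , there u′∈ , q , eq

    elems⁺ : ∀ {ws x} (ls : All (λ u → Listing (Q u)) ws) → Image Q f ws x → x ∈ elems ls
    elems⁺ (l ∷ ls) (u , b , here refl , q , refl) = ∈-++⁺ˡ (∈-map⁺ (f u) (from (complete l b) q))
    elems⁺ {u ∷ _} (l ∷ ls) (u′ , b , there u′∈ , q , eq) =
      ∈-++⁺ʳ (map (f u) (elements l)) (elems⁺ ls (u′ , b , u′∈ , q , eq))

    elems-unique : ∀ {ws} → Unique ws → (ls : All (λ u → Listing (Q u)) ws) → Unique (elems ls)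
    elems-unique [] [] = []
    elems-unique {u ∷ _} (u∉ws ∷ ws-unique) (l ∷ ls) =
      Unique.++⁺ (Unique.map⁺ (proj₂ ∘ f-injective) (unique l)) (elems-unique ws-unique ls) disjoint
      where
      disjoint : ∀ {x} → ¬ (x ∈ map (f u) (elements l) × x ∈ elems ls)
      disjoint (x∈l , x∈ls) with _ , _ , refl ← ∈-map⁻ (f u) x∈l
                            with _ , _ , u′∈ , _ , eq ← elems⁻ ls x∈ls =
        All.lookup u∉ws u′∈ (proj₁ (f-injective (sym eq)))

    elems-length : ∀ {ws} (ls : All (λ u → Listing (Q u)) ws) →
                   length (elems ls) ≡ sum (All.reduce size ls)
    elems-length [] = refl
    elems-length {u ∷ _} (l ∷ ls) = begin
      length (map (f u) (elements l) ++ elems ls)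
        ≡⟨ length-++ (map (f u) (elements l)) ⟩
      length (map (f u) (elements l)) + length (elems ls)
        ≡⟨ cong₂ _+_ (length-map (f u) (elements l)) (elems-length ls) ⟩
      size l + sum (All.reduce size ls)
        ∎
      where open ≡-Reasoning

  ⋃-listing : ∀ {ws} → Unique ws → All (λ u → Listing (Q u)) ws → Listing (Image Q f ws)
  ⋃-listing ws-unique ls = record
    { elements = elems ls
    ; unique   = elems-unique ws-unique ls
    ; complete = λ x → mk⇔ (elems⁻ ls) (elems⁺ ls) }

  ⋃-size : ∀ {ws} (ws-unique : Unique ws) (ls : All (λ u → Listing (Q u)) ws) →
           size (⋃-listing ws-unique ls) ≡ sum (All.reduce size ls)
  ⋃-size _ = elems-length

module _ {A B : Set} {L : A → Set} {R : B → Set} where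

  ⊎-listing : Listing L → Listing R → Listing [ L , R ]′
  ⊎-listing lL lR = record
    { elements = map inj₁ (elements lL) ++ map inj₂ (elements lR)
    ; unique   = Unique.++⁺ (Unique.map⁺ Sum.inj₁-injective (unique lL))
                            (Unique.map⁺ Sum.inj₂-injective (unique lR)) disjoint
    ; complete = λ v → mk⇔ (members⁻ v) (members⁺ v) }
    where
    disjoint : ∀ {v} → ¬ (v ∈ map inj₁ (elements lL) × v ∈ map inj₂ (elements lR))
    disjoint (v∈L , v∈R) with _ , _ , refl ← ∈-map⁻ inj₁ v∈L with _ , _ , () ← ∈-map⁻ inj₂ v∈R
    members⁻ : ∀ v → v ∈ map inj₁ (elements lL) ++ map inj₂ (elements lR) → [ L , R ]′ v
    members⁻ v v∈ with ∈-++⁻ (map inj₁ (elements lL)) v∈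
    ... | inj₁ v∈L with a , a∈ , refl ← ∈-map⁻ inj₁ v∈L = to (complete lL a) a∈
    ... | inj₂ v∈R with b , b∈ , refl ← ∈-map⁻ inj₂ v∈R = to (complete lR b) b∈
    members⁺ : ∀ v → [ L , R ]′ v → v ∈ map inj₁ (elements lL) ++ map inj₂ (elements lR)
    members⁺ (inj₁ a) La = ∈-++⁺ˡ (∈-map⁺ inj₁ (from (complete lL a) La))
    members⁺ (inj₂ b) Rb = ∈-++⁺ʳ (map inj₁ (elements lL)) (∈-map⁺ inj₂ (from (complete lR b) Rb))

  ⊎-size : (lL : Listing L) (lR : Listing R) → size (⊎-listing lL lR) ≡ size lL + size lR
  ⊎-size lL lR = trans (length-++ (map inj₁ (elements lL)))
                       (cong₂ _+_ (length-map inj₁ (elements lL)) (length-map inj₂ (elements lR)))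

module _ {V : Set} {R : V → V → Set} where

  data Path : V → V → List V → Set where
    []  : ∀ {x} → Path x x []
    _∷_ : ∀ {x y z vs} → R x y → Path y z vs → Path x z (y ∷ vs)

  private
    suffix : ∀ {x y z vs} → Path y z vs → Unique (y ∷ vs) → x ∈ y ∷ vs →
             ∃[ ws ] (Path x z ws × Unique (x ∷ ws))
    suffix p       y∷vs-unique        (here refl) = _ , p , y∷vs-unique
    suffix (_ ∷ p) (_ ∷ vs-unique) (there x∈) = suffix p vs-unique x∈

  simple-path : DecidableEquality V → ∀ {x z} → Star R x z → ∃[ vs ] (Path x z vs × Unique (x ∷ vs))
  simple-path _≟_ ε = _ , [] , [] ∷ []
  simple-path _≟_ {x} (r ◅ walk) with vs , p , unique-path ← simple-path _≟_ walk
                                  with DecMembership._∈?_ _≟_ x (_ ∷ vs)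
  ... | yes x∈ = suffix p unique-path x∈
  ... | no x∉ = _ , r ∷ p , ¬Any⇒All¬ _ x∉ ∷ unique-path

  closed-walk : {R′ : V → V → Set} → (∀ {u v} → R u v → R′ u v) →
                ∀ {x y z vs} → Path x z vs → R′ z y → Linked R′ (x ∷ vs ++ [ y ])
  closed-walk R⇒R′ []      r′ = r′ ∷ [-]
  closed-walk R⇒R′ (r ∷ p) r′ = R⇒R′ r ∷ closed-walk R⇒R′ p r′

module _ {V : Set} (G H : Graph V) where
  private
    module G = Graph G
    module H = Graph H

  IsTree-transport : (∀ v → H.IsVertex v → G.IsVertex v) →
                     (∀ {u v} → G.Adj u v → H.Adj u v) → (∀ {u v} → H.Adj u v → G.Adj u v) →
                     IsTree G → IsTree H
  IsTree-transport H⇒Gᵛ G⇒H H⇒G (connected , acyclic) =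
      (λ u v u∈ v∈ → Star.map G⇒H (connected u v (H⇒Gᵛ u u∈) (H⇒Gᵛ v v∈)))
    , (λ (v , vs , long , distinct , linked) →
         acyclic (v , vs , long , distinct , Linked.map H⇒G linked))

module _ {A B : Set} where

  data BipartiteAdj (E : A → B → Set) : A ⊎ B → A ⊎ B → Set where
    left→right : ∀ {a b} → E a b → BipartiteAdj E (inj₁ a) (inj₂ b)
    right→left : ∀ {a b} → E a b → BipartiteAdj E (inj₂ b) (inj₁ a)

  bipartite : (A → Set) → (B → Set) → (A → B → Set) → Graph (A ⊎ B)
  bipartite L R E = record { IsVertex = [ L , R ]′ ; Adj = BipartiteAdj E }

  BipartiteAdj-map : {E E′ : A → B → Set} → (∀ {a b} → E a b → E′ a b) →
                     ∀ {u v} → BipartiteAdj E u v → BipartiteAdj E′ u v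
  BipartiteAdj-map E⇒E′ (left→right e) = left→right (E⇒E′ e)
  BipartiteAdj-map E⇒E′ (right→left e) = right→left (E⇒E′ e)

  BipartiteAdj-sym : {E : A → B → Set} → ∀ {u v} → BipartiteAdj E u v → BipartiteAdj E v u
  BipartiteAdj-sym (left→right e) = right→left e
  BipartiteAdj-sym (right→left e) = left→right e

module BipartiteTree {A B : Set} (_≟ᴬ_ : DecidableEquality A) (_≟ᴮ_ : DecidableEquality B)
  {L : A → Set} {R : B → Set} {E : A → B → Set}
  (E⇒L : ∀ {a b} → E a b → L a) (E⇒R : ∀ {a b} → E a b → R b)
  (tree : IsTree (bipartite L R E)) {root : A ⊎ B} (root-valid : [ L , R ]′ root) where

  private
    V : Set
    V = A ⊎ B
    IsVertex : V → Set
    IsVertex = [ L , R ]′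
    TreeAdj : List (A × B) → V → V → Set
    TreeAdj T = BipartiteAdj (λ a b → (a , b) ∈ T)

  record Subtree : Set where
    field
      vertices        : List V
      edges           : List (A × B)
      vertices-unique : Unique vertices
      edges-unique    : Unique edges
      vertices-valid  : ∀ {v} → v ∈ vertices → IsVertex v
      edges-valid     : ∀ {a b} → (a , b) ∈ edges → E a b
      edges-inside    : ∀ {a b} → (a , b) ∈ edges → inj₁ a ∈ vertices × inj₂ b ∈ vertices
      one-more-vertex : suc (length edges) ≡ length vertices
      root-inside     : root ∈ vertices
      reachable       : ∀ {v} → v ∈ vertices → Star (TreeAdj edges) root v
  open Subtree

  Grows : Subtree → V → Set
  Grows st v = Σ Subtree λ st′ → vertices st ⊆ vertices st′ × v ∈ vertices st′

  singleton : Subtree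
  singleton = record
    { vertices        = [ root ]
    ; edges           = []
    ; vertices-unique = [] ∷ []
    ; edges-unique    = []
    ; vertices-valid  = λ { (here refl) → root-valid }
    ; edges-valid     = λ ()
    ; edges-inside    = λ ()
    ; one-more-vertex = refl
    ; root-inside     = here refl
    ; reachable       = λ { (here refl) → ε } }

  grow : (st : Subtree) {a : A} {b : B} {u v : V} → E a b → IsVertex v → v ∉ vertices st →
         inj₁ a ∈ v ∷ vertices st → inj₂ b ∈ v ∷ vertices st → (a , b) ∉ edges st →
         u ∈ vertices st → TreeAdj ((a , b) ∷ edges st) u v → Grows st v
  grow st {a} {b} e v-valid v∉ a∈ b∈ ab∉ u∈ u~v = record
      { vertices        = _ ∷ vertices st
      ; edges           = (a , b) ∷ edges st
      ; vertices-unique = ¬Any⇒All¬ _ v∉ ∷ vertices-unique st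
      ; edges-unique    = ¬Any⇒All¬ _ ab∉ ∷ edges-unique st
      ; vertices-valid  = λ { (here refl) → v-valid ; (there w∈) → vertices-valid st w∈ }
      ; edges-valid     = λ { (here refl) → e ; (there ab∈) → edges-valid st ab∈ }
      ; edges-inside    = λ { (here refl) → a∈ , b∈
                            ; (there ab∈) → let a∈′ , b∈′ = edges-inside st ab∈
                                            in there a∈′ , there b∈′ }
      ; one-more-vertex = cong suc (one-more-vertex st)
      ; root-inside     = there (root-inside st)
      ; reachable       = λ { (here refl) → old-walk (reachable st u∈) ◅◅ (u~v ◅ ε)
                            ; (there w∈) → old-walk (reachable st w∈) } }
    , there , here refl
    where
    old-walk : ∀ {x y} → Star (TreeAdj (edges st)) x y → Star (TreeAdj ((a , b) ∷ edges st)) x y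
    old-walk = Star.map (BipartiteAdj-map there)

  attach : (st : Subtree) {u v : V} → u ∈ vertices st → v ∉ vertices st →
           BipartiteAdj E u v → Grows st v
  attach st a∈ b∉ (left→right e) =
    grow st e (E⇒R e) b∉ (there a∈) (here refl) (b∉ ∘ proj₂ ∘ edges-inside st)
         a∈ (left→right (here refl))
  attach st b∈ a∉ (right→left e) =
    grow st e (E⇒L e) a∉ (here refl) (there b∈) (a∉ ∘ proj₁ ∘ edges-inside st)
         b∈ (right→left (here refl))

  absorb : (st : Subtree) {u v : V} → Star (BipartiteAdj E) u v → u ∈ vertices st → Grows st v
  absorb st ε u∈ = st , id , u∈
  absorb st (_◅_ {j = w} e walk) u∈ with DecMembership._∈?_ (Sum.≡-dec _≟ᴬ_ _≟ᴮ_) w (vertices st)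
  ... | yes w∈ = absorb st walk w∈
  ... | no w∉ with st′ , st⊆st′ , w∈′ ← attach st u∈ w∉ e
              with st″ , st′⊆st″ , v∈″ ← absorb st′ walk w∈′ =
    st″ , (λ x∈ → st′⊆st″ (st⊆st′ x∈)) , v∈″

  span : (vs : List V) → (∀ {v} → v ∈ vs → IsVertex v) → Σ Subtree λ st → vs ⊆ vertices st
  span []       _     = singleton , λ ()
  span (v ∷ vs) valid
    with st , vs⊆ ← span vs (valid ∘ there)
    with st′ , st⊆st′ , v∈ ← absorb st (proj₁ tree root v root-valid (valid (here refl)))
                                        (root-inside st) =
    st′ , λ { (here refl) → v∈ ; (there w∈) → st⊆st′ (vs⊆ w∈) }

  module _ (lV : Listing IsVertex) where
    private
      spanning : Σ Subtree λ st → elements lV ⊆ vertices st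
      spanning = span (elements lV) (λ {v} → to (complete lV v))

      st : Subtree
      st = proj₁ spanning

      spans : ∀ {v} → IsVertex v → v ∈ vertices st
      spans {v} = proj₂ spanning ∘ from (complete lV v)

      tree⊆graph : ∀ {u v} → TreeAdj (edges st) u v → BipartiteAdj E u v
      tree⊆graph = BipartiteAdj-map (edges-valid st)

      tree-walk : ∀ u v → IsVertex u → IsVertex v → Star (TreeAdj (edges st)) u v
      tree-walk _ _ u-valid v-valid =
        Star.reverse BipartiteAdj-sym (reachable st (spans u-valid))
          ◅◅ reachable st (spans v-valid)

      -- An edge missing from the spanning subtree would close a cycle with the subtree path
      -- between its endpoints.
      in-tree : ∀ {a b} → E a b → (a , b) ∈ edges st
      in-tree {a} {b} e with DecMembership._∈?_ (Product.≡-dec _≟ᴬ_ _≟ᴮ_) (a , b) (edges st)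
      ... | yes ab∈ = ab∈
      ... | no ab∉
        with simple-path (Sum.≡-dec _≟ᴬ_ _≟ᴮ_) (tree-walk (inj₁ a) (inj₂ b) (E⇒L e) (E⇒R e))
      ...   | _ , left→right t ∷ [] , _ = contradiction t ab∉
      ...   | _     , p@(_ ∷ _ ∷ _) , distinct =
        ⊥-elim (proj₂ tree (inj₁ a , _ , s≤s (s≤s z≤n) , distinct ,
                            closed-walk tree⊆graph p (right→left e)))

    edge-listing : Listing (uncurry E)
    edge-listing = record
      { elements = edges st
      ; unique   = edges-unique st
      ; complete = λ (a , b) → mk⇔ (edges-valid st) in-tree }

    edge-count : suc (size edge-listing) ≡ size lV
    edge-count = trans (one-more-vertex st) (size-unique vertex-listing lV)
      where
      vertex-listing : Listing IsVertex
      vertex-listing = record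
        { elements = vertices st
        ; unique   = vertices-unique st
        ; complete = λ v → mk⇔ (vertices-valid st) spans }

length-snoc : ∀ {A : Set} (u : List A) b → length (u ++ [ b ]) ≡ suc (length u)
length-snoc u b = trans (length-++ u) (+-comm (length u) 1)

record Context (m : ℕ) (B : Set) (d : ℕ) : Set where
  field
    plug           : Word m → B → Word m
    plug-injective : ∀ {u u′ b b′} → plug u b ≡ plug u′ b′ → u ≡ u′ × b ≡ b′
    plug-length    : ∀ u b → length (plug u b) ≡ d + length u
    plug-factor    : ∀ u b → Factor u (plug u b)
    plug-onto      : ∀ {n} x → length x ≡ d + n → ∃[ u ] ∃[ b ] plug u b ≡ x

module _ {m : ℕ} where

  left-context : Context m (Fin m) 1
  left-context = record
    { plug           = λ u a → a ∷ u
    ; plug-injective = swap ∘ ∷-injective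
    ; plug-length    = λ _ _ → refl
    ; plug-factor    = λ u a → [ a ] , [] , cong (a ∷_) (++-identityʳ u)
    ; plug-onto      = λ { (a ∷ u) _ → u , a , refl } }

  right-context : Context m (Fin m) 1
  right-context = record
    { plug           = λ u b → u ++ [ b ]
    ; plug-injective = ∷ʳ-injective _ _
    ; plug-length    = length-snoc
    ; plug-factor    = λ u b → [] , [ b ] , refl
    ; plug-onto      = onto }
    where
    onto : ∀ {n} (x : Word m) → length x ≡ 1 + n → ∃[ u ] ∃[ b ] u ++ [ b ] ≡ x
    onto x l with initLast x | l
    ... | u ∷ʳ′ b | _ = u , b , refl

  two-sided-context : Context m (Fin m × Fin m) 2
  two-sided-context = record
    { plug           = plug
    ; plug-injective = injective
    ; plug-length    = λ u (_ , b) → cong suc (length-snoc u b)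
    ; plug-factor    = λ u (a , b) → [ a ] , [ b ] , refl
    ; plug-onto      = onto }
    where
    plug : Word m → Fin m × Fin m → Word m
    plug u (a , b) = a ∷ u ++ [ b ]
    injective : ∀ {u u′ ab ab′} → plug u ab ≡ plug u′ ab′ → u ≡ u′ × ab ≡ ab′
    injective {u} {u′} e with refl , e′ ← ∷-injective e with refl , refl ← ∷ʳ-injective u u′ e′ =
      refl , refl
    onto : ∀ {n} (x : Word m) → length x ≡ 2 + n → ∃[ u ] ∃[ ab ] plug u ab ≡ x
    onto (a ∷ x) l with u , b , refl ← Context.plug-onto right-context x (suc-injective l) =
      u , (a , b) , refl

module _ {m : ℕ} {S : Lang m} (factorial : Factorial S) where

  prefix-closed : ∀ u v → S (u ++ v) → S u
  prefix-closed u v s = factorial _ u s ([] , v , refl)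

  suffix-closed : ∀ u v → S (u ++ v) → S v
  suffix-closed u v s = factorial _ v s (u , [] , cong (u ++_) (++-identityʳ v))

empty-layer : ∀ {m} {S : Lang m} → S [] → Listing (S ∩A^ 0)
empty-layer S[] = record
  { elements = [ [] ]
  ; unique   = [] ∷ []
  ; complete = λ x → mk⇔ (λ { (here refl) → S[] , refl }) (λ { (_ , l) → only-empty x l }) }
  where
  only-empty : ∀ x → length x ≡ 0 → x ∈ [ [] ]
  only-empty [] _ = here refl

module TreeSetLayers {m : ℕ} (S : Lang m) (tree-set : TreeSet S) where
  private
    factorial : Factorial S
    factorial = proj₁ (proj₁ tree-set)
    extendable : ∀ w → S w → ∃[ a ] ∃[ b ] S (a ∷ w ++ [ b ])
    extendable = proj₂ (proj₁ tree-set)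

  extension-tree : ∀ {w} → S w →
    IsTree (bipartite (λ a → S (a ∷ w)) (λ b → S (w ++ [ b ])) (λ a b → S (a ∷ w ++ [ b ])))
  extension-tree {w} Sw =
    IsTree-transport (ExtensionGraph S w) _ vertex adj⁺ adj⁻ (proj₂ tree-set w Sw)
    where
    vertex : ∀ v → [ (λ a → S (a ∷ w)) , (λ b → S (w ++ [ b ])) ]′ v → ExtVertex S w v
    vertex (inj₁ _) s = s
    vertex (inj₂ _) s = s
    adj⁺ : ∀ {u v} → ExtAdj S w u v → BipartiteAdj (λ a b → S (a ∷ w ++ [ b ])) u v
    adj⁺ {inj₁ _} {inj₂ _} s = left→right s
    adj⁺ {inj₂ _} {inj₁ _} s = right→left s
    adj⁻ : ∀ {u v} → BipartiteAdj (λ a b → S (a ∷ w ++ [ b ])) u v → ExtAdj S w u v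
    adj⁻ (left→right s) = s
    adj⁻ (right→left s) = s

  record Extensions (w : Word m) : Set where
    field
      left  : Listing (λ a → S (a ∷ w))
      right : Listing (λ b → S (w ++ [ b ]))
      both  : Listing (uncurry λ a b → S (a ∷ w ++ [ b ]))
      count : suc (size both) ≡ size left + size right

  extensions : ∀ {w} → S w → Decidable (λ a → S (a ∷ w)) → Decidable (λ b → S (w ++ [ b ])) →
               Extensions w
  extensions {w} Sw L? R? = record
    { left  = fin-listing L?
    ; right = fin-listing R?
    ; both  = edge-listing vertices
    ; count = trans (edge-count vertices) (⊎-size (fin-listing L?) (fin-listing R?)) }
    where
    a₀ : Fin m
    a₀ = proj₁ (extendable w Sw)
    Sa₀w : S (a₀ ∷ w)
    Sa₀w = let _ , b₀ , Sa₀wb₀ = extendable w Sw in prefix-closed factorial (a₀ ∷ w) [ b₀ ] Sa₀wb₀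
    open BipartiteTree Fin._≟_ Fin._≟_
      (λ {a} {b} → prefix-closed factorial (a ∷ w) [ b ]) (λ {a} → suffix-closed factorial [ a ] _)
      (extension-tree Sw) {inj₁ a₀} Sa₀w
    vertices : Listing [ (λ a → S (a ∷ w)) , (λ b → S (w ++ [ b ])) ]′
    vertices = ⊎-listing (fin-listing L?) (fin-listing R?)

  open Extensions

  total : ∀ {B} {Q : Word m → B → Set} → (∀ {u} → Extensions u → Listing (Q u)) →
          ∀ {ws} → All Extensions ws → ℕ
  total f ext = sum (All.reduce size (All.map f ext))

  total-count : ∀ {ws} (ext : All Extensions ws) →
                total both ext + length ws ≡ total left ext + total right ext
  total-count [] = refl
  total-count {_ ∷ ws} (x ∷ ext) = begin
    (e + total both ext) + suc (length ws)            ≡⟨ +-suc _ (length ws) ⟩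
    suc ((e + total both ext) + length ws)            ≡⟨ cong suc (+-assoc e _ (length ws)) ⟩
    suc e + (total both ext + length ws)              ≡⟨ cong₂ _+_ (count x) (total-count ext) ⟩
    (l + r) + (total left ext + total right ext)      ≡⟨ +-interchange l r _ _ ⟩
    (l + total left ext) + (r + total right ext)      ∎
    where
    open ≡-Reasoning
    e l r : ℕ
    e = size (both x)
    l = size (left x)
    r = size (right x)

  module _ {n : ℕ} (ℓ : Listing (S ∩A^ n)) where

    layer-listing : ∀ {B d} (C : Context m B d) → let open Context C in
      (ls : All (λ u → Listing (λ b → S (plug u b))) (elements ℓ)) →
      Σ (Listing (S ∩A^ (d + n))) λ ℓ′ → size ℓ′ ≡ sum (All.reduce size ls)
    layer-listing {d = d} C ls =
      Listing-cong image⇔layer (⋃-listing plug plug-injective (unique ℓ) ls) ,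
      ⋃-size plug plug-injective (unique ℓ) ls
      where
      open Context C
      image⇔layer : ∀ x → Image (λ u b → S (plug u b)) plug (elements ℓ) x ⇔ (S ∩A^ (d + n)) x
      image⇔layer x = mk⇔ out into
        where
        out : Image (λ u b → S (plug u b)) plug (elements ℓ) x → (S ∩A^ (d + n)) x
        out (u , b , u∈ , s , refl) =
          s , trans (plug-length u b) (cong (d +_) (proj₂ (to (complete ℓ u) u∈)))
        into : (S ∩A^ (d + n)) x → Image (λ u b → S (plug u b)) plug (elements ℓ) x
        into (s , l) with u , b , refl ← plug-onto x l =
          u , b , from (complete ℓ u) (factorial _ u s (plug-factor u b) , length-u) , s , refl
          where
          length-u : length u ≡ n
          length-u = +-cancelˡ-≡ d _ _ (trans (sym (plug-length u b)) l)

    layer-extensions : Listing (S ∩A^ suc n) → All Extensions (elements ℓ)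
    layer-extensions ℓ₁ = All.tabulate λ {u} u∈ → let Su , lu = to (complete ℓ u) u∈ in
      extensions Su (λ _ → decide-layer (cong suc lu))
                    (λ b → decide-layer (trans (length-snoc u b) (cong suc lu)))
      where
      decide-layer : ∀ {x} → length x ≡ suc n → Dec (S x)
      decide-layer l = Dec.map (mk⇔ proj₁ (_, l)) (decide (List.≡-dec Fin._≟_) ℓ₁ _)

    layer-recurrence : (ℓ₁ : Listing (S ∩A^ suc n)) →
      Σ (Listing (S ∩A^ suc (suc n))) λ ℓ₂ → size ℓ₂ + size ℓ ≡ size ℓ₁ + size ℓ₁
    layer-recurrence ℓ₁
      with ℓ₂ , ℓ₂-size ← layer-listing two-sided-context (All.map both (layer-extensions ℓ₁)) =
      ℓ₂ , (begin
      size ℓ₂ + size ℓ                        ≡⟨ cong (_+ size ℓ) ℓ₂-size ⟩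
      total both ext + length (elements ℓ)   ≡⟨ total-count ext ⟩
      total left ext + total right ext        ≡⟨ cong₂ _+_ (one-sided-size left-context left)
                                                           (one-sided-size right-context right) ⟨
      size ℓ₁ + size ℓ₁                       ∎)
      where
      open ≡-Reasoning
      ext : All Extensions (elements ℓ)
      ext = layer-extensions ℓ₁
      one-sided-size : (C : Context m (Fin m) 1) →
                       (f : ∀ {u} → Extensions u → Listing (λ b → S (Context.plug C u b))) →
                       size ℓ₁ ≡ total f ext
      one-sided-size C f with ℓ₁′ , ℓ₁′-size ← layer-listing C (All.map f ext) =
        trans (size-unique ℓ₁ ℓ₁′) ℓ₁′-size

  card-recurrence : ∀ {n s₀ s₁} → HasCard (S ∩A^ n) s₀ → HasCard (S ∩A^ suc n) s₁ →
                    ∃[ s₂ ] (HasCard (S ∩A^ suc (suc n)) s₂ × s₂ + s₀ ≡ s₁ + s₁)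
  card-recurrence card₀ card₁
    with ℓ₀ , refl ← fromHasCard card₀ with ℓ₁ , refl ← fromHasCard card₁
    with ℓ₂ , recurrence ← layer-recurrence ℓ₀ ℓ₁ = size ℓ₂ , toHasCard ℓ₂ , recurrence

  letter-count-positive : ∀ {c} → S [] → HasCard (S ∩A^ 1) c → 1 ≤ c
  letter-count-positive S[] card₁
    with a , b , Sab ← extendable [] S[] with ℓ₁ , refl ← fromHasCard card₁ =
    ∈-length (from (complete ℓ₁ [ a ]) (prefix-closed factorial [ a ] [ b ] Sab , refl))

second-difference : ∀ k n → (k * suc (suc n) + 1) + (k * n + 1) ≡ (k * suc n + 1) + (k * suc n + 1)
second-difference = solve-∀

linear-from-recurrence : (P : ℕ → ℕ → Set) (k : ℕ) → P 0 1 → P 1 (k + 1) →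
  (∀ {n s₀ s₁} → P n s₀ → P (suc n) s₁ → ∃[ s₂ ] (P (suc (suc n)) s₂ × s₂ + s₀ ≡ s₁ + s₁)) →
  ∀ n → P n (k * n + 1)
linear-from-recurrence P k p₀ p₁ step = proj₁ ∘ consecutive
  where
  consecutive : ∀ n → P n (k * n + 1) × P (suc n) (k * suc n + 1)
  consecutive zero = subst (λ s → P 0 (s + 1)) (sym (*-zeroʳ k)) p₀
                   , subst (λ s → P 1 (s + 1)) (sym (*-identityʳ k)) p₁
  consecutive (suc n) with pₙ , pₙ₊₁ ← consecutive n with s₂ , pₙ₊₂ , recurrence ← step pₙ pₙ₊₁ =
    pₙ₊₁ , subst (P (suc (suc n))) (+-cancelʳ-≡ _ s₂ _ (trans recurrence (sym (second-difference k n))))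
                 pₙ₊₂

proposition3p3 : (m : ℕ) → 1 ≤ m → (S : Lang m) → ∃ S → TreeSet S →
    (c : ℕ) → HasCard (S ∩A^ 1) c →
    (n : ℕ) → HasCard (S ∩A^ n) ((c ∸ 1) * n + 1)
proposition3p3 m _ S (w , Sw) tree-set@((factorial , _) , _) c card₁ =
  linear-from-recurrence (λ n → HasCard (S ∩A^ n)) (c ∸ 1)
    (toHasCard (empty-layer S[]))
    (subst (HasCard (S ∩A^ 1)) (sym (m∸n+n≡m (letter-count-positive S[] card₁))) card₁)
    card-recurrence
  where
  open TreeSetLayers S tree-set
  S[] : S []
  S[] = prefix-closed factorial [] w Sw
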